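{- Let $G$ be a signed graph with edge connectivity $\kappa_e(G)$ and frustration index $\varphi(G)$, and let $\mathcal{G}$ be its Gremban expansion with edge connectivity $\kappa_e(\mathcal{G})$. Then $\kappa_e(\mathcal{G})\le 2\min\{\kappa_e(G),\varphi(G)\}$.
   Context: A signed graph $G=(V,E,\sigma)$ has finite node set, undirected edges without loops or multi-edges, and signs $\sigma:E\to\{\pm1\}$. Its Gremban expansion $\mathcal{G}$ is the unsigned graph on nodes $v^+,v^-$ ($v\in V$) with edges $(u^\chi,v^{\chi\sigma(u,v)})$ for $(u,v)\in E$, $\chi\in\{\pm\}$. For a graph and a bipartition of its node set into $S,T$, the cut-set is $C(S,T)=\{(u,v)\in E: u\in S,v\in T\}$; the edge connectivity $\kappa_e$ is the minimum of $|C(S,T)|$ over all bipartitions into two nonempty sets. For a switching function $\theta:V\to\{\pm1\}$ the frustration set is $F(\theta)=\{uv\in E:\theta(u)\theta(v)\sigma(uv)=-1\}$ and the frustration index is $\varphi(G)=\min_\theta|F(\theta)|$. -}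

module Defs where

open import Data.Nat using (ℕ; _≤_; _<?_; _+_)
open import Data.Fin using (Fin; toℕ; splitAt)
open import Data.Bool using (Bool; true; false; _∧_; not; if_then_else_)
open import Data.Maybe using (Maybe; just; nothing; is-just)
open import Data.Sign using (Sign) renaming (_*_ to _*ˢ_)
open import Data.Sum using (inj₁; inj₂)
open import Data.List using (map; allFin)
open import Data.Nat.ListAction using (sum)
open import Data.Product using (Σ; _×_; ∃)
open import Relation.Binary.PropositionalEquality using (_≡_)
open import Relation.Nullary.Decidable using (⌊_⌋)

Σᶠ : {m : ℕ} → (Fin m → ℕ) → ℕ
Σᶠ {m} f = sum (map f (allFin m))

[_] : Bool → ℕ
[ true ] = 1
[ false ] = 0

-- A signed graph on node set Fin n: sgn u v = nothing if no edge,
-- just s if there is an edge uv with sign s.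
record SignedGraph (n : ℕ) : Set where
  field
    sgn      : Fin n → Fin n → Maybe Sign
    sgn-sym  : ∀ u v → sgn u v ≡ sgn v u
    sgn-irr  : ∀ u → sgn u u ≡ nothing
open SignedGraph public

-- bipartition (S,T) of Fin m encoded by S : Fin m → Bool (T = complement)
NonTrivial : {m : ℕ} → (Fin m → Bool) → Set
NonTrivial S = (∃ λ u → S u ≡ true) × (∃ λ v → S v ≡ false)

cutSize : {m : ℕ} → (Fin m → Fin m → Bool) → (Fin m → Bool) → ℕ
cutSize A S = Σᶠ λ u → Σᶠ λ v → [ S u ∧ not (S v) ∧ A u v ]

IsEdgeConnectivity : {m : ℕ} → (Fin m → Fin m → Bool) → ℕ → Set
IsEdgeConnectivity A k =
  (Σ _ λ S → NonTrivial S × cutSize A S ≡ k) ×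
  (∀ S → NonTrivial S → k ≤ cutSize A S)

underlyingAdj : {n : ℕ} → SignedGraph n → Fin n → Fin n → Bool
underlyingAdj G u v = is-just (sgn G u v)

-- Gremban expansion: node v⁺ is the index v in the left copy of Fin (n + n),
-- node v⁻ is the index v in the right copy.
copy : {n : ℕ} → Fin (n + n) → Sign
copy {n} i with splitAt n i
... | inj₁ _ = Sign.+
... | inj₂ _ = Sign.-

base : {n : ℕ} → Fin (n + n) → Fin n
base {n} i with splitAt n i
... | inj₁ u = u
... | inj₂ u = u

signEq : Sign → Sign → Bool
signEq Sign.+ Sign.+ = true
signEq Sign.- Sign.- = true
signEq _ _ = false

grembanAdj : {n : ℕ} → SignedGraph n → Fin (n + n) → Fin (n + n) → Bool
grembanAdj {n} G i j with sgn G (base {n} i) (base {n} j)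
... | nothing = false
... | just s  = signEq (copy {n} j) (copy {n} i *ˢ s)

-- frustration set size |F(θ)| (each unordered edge counted once, via u < v)
frustrated : Maybe Sign → Sign → Sign → Bool
frustrated nothing  _ _ = false
frustrated (just s) a b = signEq (a *ˢ b *ˢ s) Sign.-

frustrationCount : {n : ℕ} → SignedGraph n → (Fin n → Sign) → ℕ
frustrationCount G θ =
  Σᶠ λ u → Σᶠ λ v → [ ⌊ toℕ u <? toℕ v ⌋ ∧ frustrated (sgn G u v) (θ u) (θ v) ]

IsFrustrationIndex : {n : ℕ} → SignedGraph n → ℕ → Set
IsFrustrationIndex G f =
  (Σ _ λ θ → frustrationCount G θ ≡ f) ×
  (∀ θ → f ≤ frustrationCount G θ)

-- Two cuts of the Gremban expansion give the two bounds. Lifting a cut (S, T) of G to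
-- all copies of its nodes doubles it, since every edge uv has exactly the two lifts
-- (u⁺, v^σ) and (u⁻, v^−σ). For a switching function θ, the nodes v^θ(v) form a
-- nontrivial cut: both lifts of a frustrated edge cross it and no lift of a balanced
-- edge does, so it has size 2 |F(θ)|.

module Submission where

open import Defs
open import Data.Nat using (ℕ; zero; suc; _≤_; _+_; _*_; _⊓_; _<?_)
open import Data.Nat.Properties
  using ( +-*-semiring; +-identityʳ; +-assoc; ≤-trans; ≤-reflexive; *-distribˡ-⊓; ⊓-glb
        ; <-asym; ≮⇒≥; ≤-antisym)
open import Data.Nat.ListAction using () renaming (sum to sumᴸ)
open import Data.Fin using (Fin; toℕ; _↑ˡ_; _↑ʳ_)
open import Data.Fin.Properties using (splitAt-↑ˡ; splitAt-↑ʳ; toℕ-injective)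
open import Data.Bool using (Bool; true; false; _∧_; not)
open import Data.Maybe using (Maybe; just; nothing; is-just)
open import Data.Sign using (Sign; opposite) renaming (_*_ to _*ˢ_)
open import Data.List using (tabulate)
open import Data.List.Properties using (map-tabulate)
open import Data.Product using (_,_; proj₁)
open import Data.Empty using (⊥-elim)
open import Function using (_∘_; id)
open import Relation.Binary.PropositionalEquality
  using (_≡_; refl; sym; trans; cong; cong₂; module ≡-Reasoning)
open import Relation.Nullary using (yes; no)
open import Relation.Nullary.Decidable using (⌊_⌋)
open import Algebra.Properties.Semiring.Sum +-*-semiring
  using (sum; sum-syntax; ∑-distrib-+; ∑-comm; sum-cong-≗; *-distribˡ-sum)

∑-tabulate : ∀ {m} (f : Fin m → ℕ) → sumᴸ (tabulate f) ≡ sum f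
∑-tabulate {zero}  f = refl
∑-tabulate {suc m} f = cong (f Fin.zero +_) (∑-tabulate (f ∘ Fin.suc))

Σᶠ≡∑ : ∀ {m} (f : Fin m → ℕ) → Σᶠ f ≡ sum f
Σᶠ≡∑ {m} f = trans (cong sumᴸ (map-tabulate id f)) (∑-tabulate f)

Σᶠ²≡∑² : ∀ {m} (f : Fin m → Fin m → ℕ) →
  Σᶠ (λ u → Σᶠ (f u)) ≡ ∑[ u < m ] ∑[ v < m ] f u v
Σᶠ²≡∑² f = trans (Σᶠ≡∑ (λ u → Σᶠ (f u))) (sum-cong-≗ (λ u → Σᶠ≡∑ (f u)))

∑-↑ : ∀ m {k} (f : Fin (m + k) → ℕ) →
  sum f ≡ ∑[ i < m ] f (i ↑ˡ k) + ∑[ j < k ] f (m ↑ʳ j)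
∑-↑ zero    f = refl
∑-↑ (suc m) f =
  trans (cong (f Fin.zero +_) (∑-↑ m (f ∘ Fin.suc))) (sym (+-assoc (f Fin.zero) _ _))

∑-double : ∀ {n} (f : Fin n → Fin n → ℕ) →
  ∑[ u < n ] ∑[ v < n ] f u v + ∑[ u < n ] ∑[ v < n ] f v u ≡ 2 * ∑[ u < n ] ∑[ v < n ] f u v
∑-double {n} f = begin
  X + ∑[ u < n ] ∑[ v < n ] f v u ≡⟨ cong (X +_) (sym (∑-comm f)) ⟩
  X + X                           ≡⟨ cong (X +_) (sym (+-identityʳ X)) ⟩
  2 * X                           ∎
  where
  open ≡-Reasoning
  X = ∑[ u < n ] ∑[ v < n ] f u v

∑²-symmetric : ∀ {n} (R : Fin n → Fin n → Bool) →
  (∀ u v → R u v ≡ R v u) → (∀ u → R u u ≡ false) →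
  ∑[ u < n ] ∑[ v < n ] [ R u v ] ≡
  2 * ∑[ u < n ] ∑[ v < n ] [ ⌊ toℕ u <? toℕ v ⌋ ∧ R u v ]
∑²-symmetric {n} R sym-R irr-R = begin
  ∑[ u < n ] ∑[ v < n ] [ R u v ]
    ≡⟨ sum-cong-≗ (λ u → trans (sum-cong-≗ (split u))
                               (∑-distrib-+ (below u) (λ v → below v u))) ⟩
  ∑[ u < n ] (∑[ v < n ] below u v + ∑[ v < n ] below v u)
    ≡⟨ ∑-distrib-+ (λ u → ∑[ v < n ] below u v) (λ u → ∑[ v < n ] below v u) ⟩
  ∑[ u < n ] ∑[ v < n ] below u v + ∑[ u < n ] ∑[ v < n ] below v u
    ≡⟨ ∑-double below ⟩
  2 * ∑[ u < n ] ∑[ v < n ] below u v ∎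
  where
  open ≡-Reasoning
  below : Fin n → Fin n → ℕ
  below u v = [ ⌊ toℕ u <? toℕ v ⌋ ∧ R u v ]
  split : ∀ u v → [ R u v ] ≡ below u v + below v u
  split u v with toℕ u <? toℕ v | toℕ v <? toℕ u
  ... | yes u<v | yes v<u = ⊥-elim (<-asym u<v v<u)
  ... | yes _   | no _    = sym (+-identityʳ _)
  ... | no _    | yes _   = cong [_] (sym-R u v)
  ... | no u≮v  | no v≮u rewrite toℕ-injective (≤-antisym (≮⇒≥ v≮u) (≮⇒≥ u≮v)) =
    cong [_] (irr-R _)

∑± : (Sign → ℕ) → ℕ
∑± g = g Sign.+ + g Sign.-

∑±-distrib-∑ : ∀ {n} (f : Sign → Fin n → ℕ) →
  ∑± (λ χ → ∑[ v < n ] f χ v) ≡ ∑[ v < n ] ∑± (λ χ → f χ v)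
∑±-distrib-∑ f = sym (∑-distrib-+ (f Sign.+) (f Sign.-))

signEq-refl : ∀ a → signEq a a ≡ true
signEq-refl Sign.+ = refl
signEq-refl Sign.- = refl

signEq-opposite : ∀ a → signEq (opposite a) a ≡ false
signEq-opposite Sign.+ = refl
signEq-opposite Sign.- = refl

frustrated-sym : ∀ m a b → frustrated m a b ≡ frustrated m b a
frustrated-sym nothing  a      b      = refl
frustrated-sym (just s) Sign.+ Sign.+ = refl
frustrated-sym (just s) Sign.+ Sign.- = refl
frustrated-sym (just s) Sign.- Sign.+ = refl
frustrated-sym (just s) Sign.- Sign.- = refl

liftsEdge : Maybe Sign → Sign → Sign → Bool
liftsEdge nothing  χ ψ = false
liftsEdge (just s) χ ψ = signEq ψ (χ *ˢ s)

liftsEdge-twice : ∀ x y m →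
  ∑± (λ χ → ∑± (λ ψ → [ x ∧ not y ∧ liftsEdge m χ ψ ])) ≡
  2 * [ x ∧ not y ∧ is-just m ]
liftsEdge-twice false y     m               = refl
liftsEdge-twice true  true  m               = refl
liftsEdge-twice true  false nothing         = refl
liftsEdge-twice true  false (just Sign.+)   = refl
liftsEdge-twice true  false (just Sign.-)   = refl

liftsEdge-switched : ∀ a b m →
  ∑± (λ χ → ∑± (λ ψ → [ signEq χ a ∧ not (signEq ψ b) ∧ liftsEdge m χ ψ ])) ≡
  [ frustrated m a b ]
liftsEdge-switched Sign.+ Sign.+ nothing       = refl
liftsEdge-switched Sign.+ Sign.- nothing       = refl
liftsEdge-switched Sign.- Sign.+ nothing       = refl
liftsEdge-switched Sign.- Sign.- nothing       = refl
liftsEdge-switched Sign.+ Sign.+ (just Sign.+) = refl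
liftsEdge-switched Sign.+ Sign.- (just Sign.+) = refl
liftsEdge-switched Sign.- Sign.+ (just Sign.+) = refl
liftsEdge-switched Sign.- Sign.- (just Sign.+) = refl
liftsEdge-switched Sign.+ Sign.+ (just Sign.-) = refl
liftsEdge-switched Sign.+ Sign.- (just Sign.-) = refl
liftsEdge-switched Sign.- Sign.+ (just Sign.-) = refl
liftsEdge-switched Sign.- Sign.- (just Sign.-) = refl

module _ {n : ℕ} where

  node : Sign → Fin n → Fin (n + n)
  node Sign.+ u = u ↑ˡ n
  node Sign.- u = n ↑ʳ u

  base-node : ∀ χ u → base {n} (node χ u) ≡ u
  base-node Sign.+ u rewrite splitAt-↑ˡ n u n = refl
  base-node Sign.- u rewrite splitAt-↑ʳ n n u = refl

  copy-node : ∀ χ u → copy {n} (node χ u) ≡ χ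
  copy-node Sign.+ u rewrite splitAt-↑ˡ n u n = refl
  copy-node Sign.- u rewrite splitAt-↑ʳ n n u = refl

  ∑-nodes : (f : Fin (n + n) → ℕ) → sum f ≡ ∑[ u < n ] ∑± (λ χ → f (node χ u))
  ∑-nodes f = trans (∑-↑ n f) (sym (∑-distrib-+ (f ∘ node Sign.+) (f ∘ node Sign.-)))

  ∑²-nodes : (f : Fin (n + n) → Fin (n + n) → ℕ) →
    ∑[ i < n + n ] ∑[ j < n + n ] f i j ≡
    ∑[ u < n ] ∑[ v < n ] ∑± (λ χ → ∑± (λ ψ → f (node χ u) (node ψ v)))
  ∑²-nodes f = begin
    ∑[ i < n + n ] ∑[ j < n + n ] f i j
      ≡⟨ ∑-nodes (λ i → ∑[ j < n + n ] f i j) ⟩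
    ∑[ u < n ] ∑± (λ χ → ∑[ j < n + n ] f (node χ u) j)
      ≡⟨ sum-cong-≗ (λ u → cong₂ _+_ (∑-nodes (f (node Sign.+ u)))
                                     (∑-nodes (f (node Sign.- u)))) ⟩
    ∑[ u < n ] ∑± (λ χ → ∑[ v < n ] ∑± (λ ψ → f (node χ u) (node ψ v)))
      ≡⟨ sum-cong-≗ (λ u → ∑±-distrib-∑ (λ χ v → ∑± (λ ψ → f (node χ u) (node ψ v)))) ⟩
    ∑[ u < n ] ∑[ v < n ] ∑± (λ χ → ∑± (λ ψ → f (node χ u) (node ψ v))) ∎
    where open ≡-Reasoning

  lift-nonTrivial : (S : Fin n → Bool) → NonTrivial S → NonTrivial (S ∘ base {n})
  lift-nonTrivial S ((u , u∈S) , (v , v∉S)) =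
    (node Sign.+ u , trans (cong S (base-node Sign.+ u)) u∈S) ,
    (node Sign.+ v , trans (cong S (base-node Sign.+ v)) v∉S)

  switchingSet : (Fin n → Sign) → Fin (n + n) → Bool
  switchingSet θ i = signEq (copy {n} i) (θ (base {n} i))

  switchingSet-node : ∀ θ χ u → switchingSet θ (node χ u) ≡ signEq χ (θ u)
  switchingSet-node θ χ u rewrite copy-node χ u | base-node χ u = refl

  switchingSet-nonTrivial : ∀ θ → Fin n → NonTrivial (switchingSet θ)
  switchingSet-nonTrivial θ u =
    (node (θ u) u , trans (switchingSet-node θ (θ u) u) (signEq-refl (θ u))) ,
    (node (opposite (θ u)) u , trans (switchingSet-node θ (opposite (θ u)) u) (signEq-opposite (θ u)))

module _ {n : ℕ} (G : SignedGraph n) where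

  grembanAdj≡liftsEdge : ∀ i j →
    grembanAdj G i j ≡ liftsEdge (sgn G (base {n} i) (base {n} j)) (copy {n} i) (copy {n} j)
  grembanAdj≡liftsEdge i j with sgn G (base {n} i) (base {n} j)
  ... | nothing = refl
  ... | just s  = refl

  grembanAdj-node : ∀ χ u ψ v → grembanAdj G (node χ u) (node ψ v) ≡ liftsEdge (sgn G u v) χ ψ
  grembanAdj-node χ u ψ v rewrite grembanAdj≡liftsEdge (node χ u) (node ψ v)
    | base-node χ u | base-node ψ v | copy-node χ u | copy-node ψ v = refl

  cutSize-gremban : (S : Fin (n + n) → Bool) →
    cutSize (grembanAdj G) S ≡
    ∑[ u < n ] ∑[ v < n ] ∑± (λ χ → ∑± (λ ψ →
      [ S (node χ u) ∧ not (S (node ψ v)) ∧ liftsEdge (sgn G u v) χ ψ ]))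
  cutSize-gremban S = trans (Σᶠ²≡∑² crosses) (trans (∑²-nodes {n} crosses)
    (sum-cong-≗ λ u → sum-cong-≗ λ v →
      cong₂ _+_ (cong₂ _+_ (crossing Sign.+ u Sign.+ v) (crossing Sign.+ u Sign.- v))
                (cong₂ _+_ (crossing Sign.- u Sign.+ v) (crossing Sign.- u Sign.- v))))
    where
    crosses : Fin (n + n) → Fin (n + n) → ℕ
    crosses i j = [ S i ∧ not (S j) ∧ grembanAdj G i j ]
    crossing : ∀ χ u ψ v →
      [ S (node χ u) ∧ not (S (node ψ v)) ∧ grembanAdj G (node χ u) (node ψ v) ] ≡
      [ S (node χ u) ∧ not (S (node ψ v)) ∧ liftsEdge (sgn G u v) χ ψ ]
    crossing χ u ψ v =
      cong (λ b → [ S (node χ u) ∧ not (S (node ψ v)) ∧ b ]) (grembanAdj-node χ u ψ v)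

  liftedCut : (S : Fin n → Bool) →
    cutSize (grembanAdj G) (S ∘ base {n}) ≡ 2 * cutSize (underlyingAdj G) S
  liftedCut S = begin
    cutSize (grembanAdj G) (S ∘ base {n})
      ≡⟨ cutSize-gremban (S ∘ base {n}) ⟩
    _ ≡⟨ sum-cong-≗ (λ u → sum-cong-≗ (lifts u)) ⟩
    ∑[ u < n ] ∑[ v < n ] (2 * crosses u v)
      ≡⟨ sum-cong-≗ (λ u → sym (*-distribˡ-sum 2 (crosses u))) ⟩
    ∑[ u < n ] (2 * ∑[ v < n ] crosses u v)
      ≡⟨ sym (*-distribˡ-sum 2 (λ u → ∑[ v < n ] crosses u v)) ⟩
    2 * ∑[ u < n ] ∑[ v < n ] crosses u v
      ≡⟨ cong (2 *_) (sym (Σᶠ²≡∑² crosses)) ⟩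
    2 * cutSize (underlyingAdj G) S ∎
    where
    open ≡-Reasoning
    crosses : Fin n → Fin n → ℕ
    crosses u v = [ S u ∧ not (S v) ∧ underlyingAdj G u v ]
    lifts : ∀ u v →
      ∑± (λ χ → ∑± (λ ψ →
        [ S (base {n} (node χ u)) ∧ not (S (base {n} (node ψ v))) ∧ liftsEdge (sgn G u v) χ ψ ]))
      ≡ 2 * crosses u v
    lifts u v rewrite base-node Sign.+ u | base-node Sign.- u | base-node Sign.+ v | base-node Sign.- v =
      liftsEdge-twice (S u) (S v) (sgn G u v)

  switchingCut : (θ : Fin n → Sign) →
    cutSize (grembanAdj G) (switchingSet θ) ≡ 2 * frustrationCount G θ
  switchingCut θ = begin
    cutSize (grembanAdj G) (switchingSet θ)
      ≡⟨ cutSize-gremban (switchingSet θ) ⟩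
    _ ≡⟨ sum-cong-≗ (λ u → sum-cong-≗ (lifts u)) ⟩
    ∑[ u < n ] ∑[ v < n ] [ F u v ]
      ≡⟨ ∑²-symmetric F F-sym F-irr ⟩
    2 * ∑[ u < n ] ∑[ v < n ] [ ⌊ toℕ u <? toℕ v ⌋ ∧ F u v ]
      ≡⟨ cong (2 *_) (sym (Σᶠ²≡∑² (λ u v → [ ⌊ toℕ u <? toℕ v ⌋ ∧ F u v ]))) ⟩
    2 * frustrationCount G θ ∎
    where
    open ≡-Reasoning
    F : Fin n → Fin n → Bool
    F u v = frustrated (sgn G u v) (θ u) (θ v)
    F-sym : ∀ u v → F u v ≡ F v u
    F-sym u v rewrite sgn-sym G u v = frustrated-sym (sgn G v u) (θ u) (θ v)
    F-irr : ∀ u → F u u ≡ false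
    F-irr u rewrite sgn-irr G u = refl
    lifts : ∀ u v →
      ∑± (λ χ → ∑± (λ ψ →
        [ switchingSet θ (node χ u) ∧ not (switchingSet θ (node ψ v)) ∧ liftsEdge (sgn G u v) χ ψ ]))
      ≡ [ F u v ]
    lifts u v rewrite switchingSet-node θ Sign.+ u | switchingSet-node θ Sign.- u
                    | switchingSet-node θ Sign.+ v | switchingSet-node θ Sign.- v =
      liftsEdge-switched (θ u) (θ v) (sgn G u v)

proposition8 : {n : ℕ} (G : SignedGraph n) (kG kGG f : ℕ) →
    IsEdgeConnectivity (underlyingAdj G) kG →
    IsFrustrationIndex G f →
    IsEdgeConnectivity (grembanAdj G) kGG →
    kGG ≤ 2 * (kG ⊓ f)
proposition8 {n} G kG kGG f ((S , S-nonTrivial , cut≡kG) , _) ((θ , frustration≡f) , _) (_ , kGG-min) =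
  ≤-trans (⊓-glb kGG≤2kG kGG≤2f) (≤-reflexive (sym (*-distribˡ-⊓ 2 kG f)))
  where
  someNode : Fin n
  someNode = proj₁ (proj₁ S-nonTrivial)
  kGG≤2kG : kGG ≤ 2 * kG
  kGG≤2kG = ≤-trans (kGG-min (S ∘ base {n}) (lift-nonTrivial S S-nonTrivial))
                    (≤-reflexive (trans (liftedCut G S) (cong (2 *_) cut≡kG)))
  kGG≤2f : kGG ≤ 2 * f
  kGG≤2f = ≤-trans (kGG-min (switchingSet θ) (switchingSet-nonTrivial θ someNode))
                   (≤-reflexive (trans (switchingCut G θ) (cong (2 *_) frustration≡f)))
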